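{- Let $G$ be a graph with $\gamma_R(G)=\frac{3}{2}\gamma_{r2}(G)$, and let $f$ be a $2$-rainbow dominating function of $G$ of weight $\gamma_{r2}(G)$. For $F\in 2^{\{1,2\}}$ let $V_F=f^{ -1}(F)$ and $n_F=|V_F|$. Then: (i) $n_{\{1\}}=n_{\{2\}}$ and $n_{\{1,2\}}=0$; (ii) there are no edges between $V_{\{1\}}$ and $V_{\{2\}}$; (iii) for $i\in\{1,2\}$, the maximum degree of the induced subgraph $G[V_{\{i\}}]$ is at most $1$; (iv) for $i\in\{1,2\}$, every vertex in $V_{\emptyset}$ has at least $1$ and at most $2$ neighbors in $V_{\{i\}}$; (v) for $i\in\{1,2\}$, every vertex $u\in V_{\{i\}}$ has at least $2$ neighbors $v\in V_{\emptyset}$ with $N_G(v)\cap V_{\{i\}}=\{u\}$.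
   Context: All graphs are finite, simple and undirected; $N_G(v)$ denotes the set of neighbors of $v$ in $G$. A $2$-rainbow dominating function of a graph $G$ is a function $f:V(G)\to 2^{\{1,2\}}$ such that $\bigcup_{v\in N_G(u)} f(v)=\{1,2\}$ for every vertex $u$ with $f(u)=\emptyset$; its weight is $\sum_{u\in V(G)}|f(u)|$, and $\gamma_{r2}(G)$ is the minimum weight of a $2$-rainbow dominating function of $G$. A Roman dominating function of $G$ is a function $g:V(G)\to\{0,1,2\}$ such that every vertex $u$ with $g(u)=0$ has a neighbor $v$ with $g(v)=2$; its weight is $\sum_{u\in V(G)} g(u)$, and $\gamma_R(G)$ is the minimum weight of a Roman dominating function of $G$. -}

module Defs where

open import Data.Nat using (ℕ; zero; suc; _+_; _≤_)
open import Data.Fin using (Fin; zero; suc; toℕ; _≟_)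
open import Data.Bool using (Bool; true; false; T; _∧_; _∨_; not)
open import Data.List using (List; length; filterᵇ; allFin; map)
open import Data.Bool.ListAction using (and)
open import Data.Nat.ListAction using (sum)
open import Data.Product using (Σ; _×_; ∃; ∃-syntax)
open import Relation.Binary.PropositionalEquality using (_≡_)
open import Relation.Nullary.Decidable using (⌊_⌋)

record Graph (n : ℕ) : Set where
  field
    adj   : Fin n → Fin n → Bool
    sym   : ∀ u v → adj u v ≡ adj v u
    irrefl : ∀ u → adj u u ≡ false
open Graph public

-- Subsets of {1,2}: ∅, {1}, {2}, {1,2}
data Label : Set where
  ∅ one two both : Label

_==L_ : Label → Label → Bool
∅ ==L ∅ = true
one ==L one = true
two ==L two = true
both ==L both = true
_ ==L _ = false

has1 : Label → Bool
has1 one = true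
has1 both = true
has1 _ = false

has2 : Label → Bool
has2 two = true
has2 both = true
has2 _ = false

size : Label → ℕ
size ∅ = 0
size one = 1
size two = 1
size both = 2

count : ∀ {n} → (Fin n → Bool) → ℕ
count {n} p = length (filterᵇ p (allFin n))

total : ∀ {n} → (Fin n → ℕ) → ℕ
total {n} w = sum (map w (allFin n))

-- 2-rainbow dominating function: every u with f u = ∅ has
-- ⋃_{v ∈ N(u)} f v = {1,2}, i.e. 1 and 2 each lie in f v for some neighbour v.
Is2RDF : ∀ {n} → Graph n → (Fin n → Label) → Set
Is2RDF {n} G f = ∀ u → f u ≡ ∅ →
  (∃[ v ] (T (adj G u v) × T (has1 (f v)))) ×
  (∃[ v ] (T (adj G u v) × T (has2 (f v))))

weightR2 : ∀ {n} → (Fin n → Label) → ℕ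
weightR2 f = total (λ v → size (f v))

IsGammaR2 : ∀ {n} → Graph n → ℕ → Set
IsGammaR2 {n} G k =
  (Σ (Fin n → Label) λ f → Is2RDF G f × weightR2 f ≡ k) ×
  (∀ (f : Fin n → Label) → Is2RDF G f → k ≤ weightR2 f)

IsRDF : ∀ {n} → Graph n → (Fin n → Fin 3) → Set
IsRDF {n} G g = ∀ u → g u ≡ zero →
  ∃[ v ] (T (adj G u v) × g v ≡ suc (suc zero))

weightR : ∀ {n} → (Fin n → Fin 3) → ℕ
weightR g = total (λ v → toℕ (g v))

IsGammaR : ∀ {n} → Graph n → ℕ → Set
IsGammaR {n} G k =
  (Σ (Fin n → Fin 3) λ g → IsRDF G g × weightR g ≡ k) ×
  (∀ (g : Fin n → Fin 3) → IsRDF G g → k ≤ weightR g)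

nF : ∀ {n} → (Fin n → Label) → Label → ℕ
nF f F = count (λ v → f v ==L F)

degIn : ∀ {n} → Graph n → (Fin n → Label) → Label → Fin n → ℕ
degIn G f F u = count (λ v → adj G u v ∧ (f v ==L F))

-- N(v) ∩ V_F = {u}, given as: u ∈ N(v) ∩ V_F, and every w ∈ N(v) ∩ V_F equals u
privateNbr : ∀ {n} → Graph n → (Fin n → Label) → Label → Fin n → Fin n → Bool
privateNbr {n} G f F u v =
  (adj G v u ∧ (f u ==L F)) ∧
  and (map (λ w → not (adj G v w ∧ (f w ==L F)) ∨ ⌊ w ≟ u ⌋) (allFin n))

privCount : ∀ {n} → Graph n → (Fin n → Label) → Label → Fin n → ℕ
privCount G f F u = count (λ v → (f v ==L ∅) ∧ privateNbr G f F u v)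

data Single : Label → Set where
  s1 : Single one
  s2 : Single two

-- From a 2-rainbow dominating function f and a colour i one gets a Roman dominating function
-- (value 2 on labels containing i, value 1 on the other singleton) of weight w(f) + n_{i}.
-- As w(f) = n₁ + n₂ + 2n₁₂ and 2γ_R = 3γ_r2, minimality of γ_R forces n₁₂ = 0 and n₁ = n₂,
-- and both Roman functions are minimum. Each of (ii)–(v) then holds because its failure would
-- let one of them be made lighter by a local change: raise one vertex to 2 and lower the
-- vertices that it now dominates.
module Submission where

open import Defs hiding (sym)
open import Data.Nat using (ℕ; zero; suc; _+_; _*_; _≤_; _<_; z≤n; s≤s)
open import Data.Nat.Properties
  using ( +-0-commutativeMonoid; +-comm; +-assoc; +-identityʳ; +-cancelˡ-≡; +-cancelʳ-≡
        ; +-cancelˡ-≤; +-cancelʳ-≤; +-cancelʳ-<; +-monoʳ-<; *-monoʳ-≤; *-cancelˡ-≡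
        ; ≤-reflexive; ≤-trans; ≤-antisym; ≤-pred; <-≤-trans; <-irrefl; ≮⇒≥
        ; m≤m+n; n≤0⇒n≡0; m+n≡0⇒m≡0; module ≤-Reasoning )
open import Data.Nat.Tactic.RingSolver using (solve-∀)
open import Data.Nat.ListAction using (sum)
open import Data.Fin using (Fin; zero; suc; toℕ; punchIn; _≟_)
open import Data.Fin.Patterns using (0F; 1F; 2F)
open import Data.Fin.Properties using (punchInᵢ≢i)
open import Data.Vec.Functional using (updateAt)
open import Data.Vec.Functional.Properties using (updateAt-updates; updateAt-minimal)
open import Data.Bool using (Bool; true; false; T; _∧_; _∨_; not; if_then_else_)
open import Data.Bool.ListAction using (all)
open import Data.Bool.Properties using (T-∧)
open import Data.List using (List; []; _∷_; length; filterᵇ; allFin; map; tabulate)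
open import Data.List.Properties using (map-tabulate)
open import Data.List.Membership.Propositional using (_∈_)
open import Data.List.Membership.Propositional.Properties using (∈-filter⁺; ∈-filter⁻; ∈-allFin)
open import Data.List.Relation.Unary.Any using (here; there; satisfied)
open import Data.List.Relation.Unary.Any.Properties using (¬Any[])
open import Data.List.Relation.Unary.All.Properties using (all⁻)
open import Data.List.Relation.Unary.All.Properties.Core using (¬All⇒Any¬)
open import Data.Product using (_×_; _,_; proj₁; proj₂; ∃-syntax)
open import Data.Sum using (_⊎_; inj₁; inj₂; [_,_])
open import Data.Empty using (⊥)
open import Function using (_∘_; const; Equivalence)
open import Relation.Binary.PropositionalEquality hiding ([_])
open import Relation.Nullary using (¬_; yes; no; contradiction)
open import Relation.Nullary.Decidable using (T?; fromWitness; ⌊_⌋)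
import Algebra.Properties.CommutativeMonoid.Sum as CommutativeMonoidSum

open CommutativeMonoidSum +-0-commutativeMonoid using (sum-remove; ∑-distrib-+; sum-cong-≗)
  renaming (sum to ∑)

-- Sums and counts over Fin n

sum-tabulate : ∀ {n} (w : Fin n → ℕ) → sum (tabulate w) ≡ ∑ w
sum-tabulate {zero}  w = refl
sum-tabulate {suc n} w = cong (w zero +_) (sum-tabulate (w ∘ suc))

total≡∑ : ∀ {n} (w : Fin n → ℕ) → total w ≡ ∑ w
total≡∑ w = trans (cong sum (map-tabulate (λ i → i) w)) (sum-tabulate w)

total-cong : ∀ {n} {w v : Fin n → ℕ} → w ≗ v → total w ≡ total v
total-cong {w = w} {v} w≗v = trans (total≡∑ w) (trans (sum-cong-≗ w≗v) (sym (total≡∑ v)))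

total-+ : ∀ {n} (w v : Fin n → ℕ) → total (λ x → w x + v x) ≡ total w + total v
total-+ w v = trans (total≡∑ (λ x → w x + v x)) (trans (∑-distrib-+ w v) (sym (cong₂ _+_ (total≡∑ w) (total≡∑ v))))

total-change : ∀ {n} (w w′ : Fin n → ℕ) (i : Fin n) → (∀ j → j ≢ i → w′ j ≡ w j) →
  total w + w′ i ≡ total w′ + w i
total-change {suc n} w w′ i same = begin
  total w + w′ i                     ≡⟨ cong (_+ w′ i) (trans (total≡∑ w) (sum-remove {i = i} w)) ⟩
  w i + rest + w′ i                  ≡⟨ +-assoc (w i) rest (w′ i) ⟩
  w i + (rest + w′ i)                ≡⟨ cong (w i +_) (+-comm rest (w′ i)) ⟩
  w i + (w′ i + rest)                ≡⟨ +-comm (w i) (w′ i + rest) ⟩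
  w′ i + rest + w i                  ≡⟨ cong (λ r → w′ i + r + w i) (sum-cong-≗ λ j → sym (same _ (punchInᵢ≢i i j))) ⟩
  w′ i + ∑ (w′ ∘ punchIn i) + w i    ≡⟨ cong (_+ w i) (trans (total≡∑ w′) (sum-remove {i = i} w′)) ⟨
  total w′ + w i                     ∎
  where
  open ≡-Reasoning
  rest : ℕ
  rest = ∑ (w ∘ punchIn i)

𝟙 : Bool → ℕ
𝟙 b = if b then 1 else 0

length-filterᵇ : ∀ {A : Set} (p : A → Bool) (xs : List A) → length (filterᵇ p xs) ≡ sum (map (𝟙 ∘ p) xs)
length-filterᵇ p [] = refl
length-filterᵇ p (x ∷ xs) with p x
... | true  = cong suc (length-filterᵇ p xs)
... | false = length-filterᵇ p xs

count≡total : ∀ {n} (p : Fin n → Bool) → count p ≡ total (𝟙 ∘ p)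
count≡total {n} p = length-filterᵇ p (allFin n)

∈-witnesses⁺ : ∀ {n} {p : Fin n → Bool} {x} → T (p x) → x ∈ filterᵇ p (allFin n)
∈-witnesses⁺ {p = p} {x} px = ∈-filter⁺ (T? ∘ p) (∈-allFin x) px

∈-witnesses⁻ : ∀ {n} {p : Fin n → Bool} {x} → x ∈ filterᵇ p (allFin n) → T (p x)
∈-witnesses⁻ {n} {p = p} x∈ = proj₂ (∈-filter⁻ (T? ∘ p) {xs = allFin n} x∈)

count≥1 : ∀ {n} (p : Fin n → Bool) {x} → T (p x) → 1 ≤ count p
count≥1 p px = nonempty (∈-witnesses⁺ {p = p} px)
  where
  nonempty : ∀ {A : Set} {x : A} {ys} → x ∈ ys → 1 ≤ length ys
  nonempty (here _)  = s≤s z≤n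
  nonempty (there _) = s≤s z≤n

at-most-one : ∀ {A : Set} {P : A → Set} (ys : List A) →
  (∀ {x} → P x → x ∈ ys) → (∀ {x} → x ∈ ys → P x) → length ys ≤ 1 →
  (∀ x → ¬ P x) ⊎ ∃[ a ] (P a × ∀ x → P x → x ≡ a)
at-most-one []       complete sound _ = inj₁ λ _ px → ¬Any[] (complete px)
at-most-one (a ∷ []) complete sound _ = inj₂ (a , sound (here refl) , λ x px → only (complete px))
  where
  only : ∀ {x} → x ∈ a ∷ [] → x ≡ a
  only (here x≡a) = x≡a
at-most-one (_ ∷ _ ∷ _) _ _ (s≤s ())

count≤1 : ∀ {n} (p : Fin n → Bool) → count p ≤ 1 →
  (∀ x → ¬ T (p x)) ⊎ ∃[ a ] (T (p a) × ∀ x → T (p x) → x ≡ a)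
count≤1 {n} p = at-most-one (filterᵇ p (allFin n)) (∈-witnesses⁺ {p = p}) (∈-witnesses⁻ {p = p})

-- Roman dominating functions under local changes

infixl 6 _[_]≔_
_[_]≔_ : ∀ {n} {A : Set} → (Fin n → A) → Fin n → A → Fin n → A
g [ i ]≔ c = updateAt g i (const c)

[]≔-updates : ∀ {n} {A : Set} (g : Fin n → A) i (c : A) → (g [ i ]≔ c) i ≡ c
[]≔-updates g i c = updateAt-updates i g

[]≔-minimal : ∀ {n} {A : Set} (g : Fin n → A) {i j} (c : A) → j ≢ i → (g [ i ]≔ c) j ≡ g j
[]≔-minimal g {i} {j} c j≢i = updateAt-minimal j i g j≢i

weightR-update : ∀ {n} (g : Fin n → Fin 3) i c → weightR g + toℕ c ≡ weightR (g [ i ]≔ c) + toℕ (g i)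
weightR-update g i c = subst (λ d → weightR g + toℕ d ≡ weightR (g [ i ]≔ c) + toℕ (g i)) ([]≔-updates g i c)
  (total-change (toℕ ∘ g) (toℕ ∘ (g [ i ]≔ c)) i (λ j j≢i → cong toℕ ([]≔-minimal g c j≢i)))

weightR-lower : ∀ {n} (g : Fin n → Fin 3) i c k → toℕ (g i) ≡ k + toℕ c →
  weightR g ≡ k + weightR (g [ i ]≔ c)
weightR-lower g i c k gi≡k+c = +-cancelʳ-≡ (toℕ c) _ _ (begin
  weightR g + toℕ c                      ≡⟨ weightR-update g i c ⟩
  weightR (g [ i ]≔ c) + toℕ (g i)       ≡⟨ cong (weightR (g [ i ]≔ c) +_) gi≡k+c ⟩
  weightR (g [ i ]≔ c) + (k + toℕ c)     ≡⟨ +-assoc (weightR (g [ i ]≔ c)) k (toℕ c) ⟨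
  weightR (g [ i ]≔ c) + k + toℕ c       ≡⟨ cong (_+ toℕ c) (+-comm (weightR (g [ i ]≔ c)) k) ⟩
  k + weightR (g [ i ]≔ c) + toℕ c       ∎)
  where open ≡-Reasoning

weightR-raise : ∀ {n} (g : Fin n → Fin 3) i c k → toℕ c ≡ k + toℕ (g i) →
  weightR (g [ i ]≔ c) ≡ k + weightR g
weightR-raise g i c k c≡k+gi = +-cancelʳ-≡ (toℕ (g i)) _ _ (begin
  weightR (g [ i ]≔ c) + toℕ (g i)       ≡⟨ weightR-update g i c ⟨
  weightR g + toℕ c                      ≡⟨ cong (weightR g +_) c≡k+gi ⟩
  weightR g + (k + toℕ (g i))            ≡⟨ +-assoc (weightR g) k (toℕ (g i)) ⟨
  weightR g + k + toℕ (g i)              ≡⟨ cong (_+ toℕ (g i)) (+-comm (weightR g) k) ⟩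
  k + weightR g + toℕ (g i)              ∎)
  where open ≡-Reasoning

clear : ∀ {n} → (Fin n → Bool) → (Fin n → Fin 3) → Fin n → Fin 3
clear p h x = if p x then 0F else h x

weightR-clear : ∀ {n} (p : Fin n → Bool) (h : Fin n → Fin 3) → (∀ x → T (p x) → h x ≡ 1F) →
  weightR h ≡ count p + weightR (clear p h)
weightR-clear p h ones = begin
  total (toℕ ∘ h)                                ≡⟨ total-cong pointwise ⟩
  total (λ x → 𝟙 (p x) + toℕ (clear p h x))      ≡⟨ total-+ (𝟙 ∘ p) (toℕ ∘ clear p h) ⟩
  total (𝟙 ∘ p) + weightR (clear p h)            ≡⟨ cong (_+ weightR (clear p h)) (count≡total p) ⟨
  count p + weightR (clear p h)                  ∎
  where
  open ≡-Reasoning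
  pointwise : ∀ x → toℕ (h x) ≡ 𝟙 (p x) + toℕ (clear p h x)
  pointwise x with p x in px
  ... | true  = cong toℕ (ones x (subst T (sym px) _))
  ... | false = refl

clear-keeps-2 : ∀ {n} (p : Fin n → Bool) {h : Fin n → Fin 3} → (∀ x → T (p x) → h x ≡ 1F) →
  ∀ {y} → h y ≡ 2F → clear p h y ≡ 2F
clear-keeps-2 p ones {y} hy with p y in py
... | true  = contradiction (trans (sym hy) (ones y (subst T (sym py) _))) λ ()
... | false = hy

module _ {n} (G : Graph n) where

  adj-sym : ∀ {x y} → T (adj G x y) → T (adj G y x)
  adj-sym {x} {y} = subst T (Graph.sym G x y)

  adj⇒≢ : ∀ {x y} → T (adj G x y) → x ≢ y
  adj⇒≢ {x} xy refl = subst T (irrefl G x) xy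

  IsRDF-raise : ∀ {g} i → IsRDF G g → IsRDF G (g [ i ]≔ 2F)
  IsRDF-raise {g} i rdf x hx with x ≟ i
  ... | yes refl = contradiction (trans (sym ([]≔-updates g i 2F)) hx) λ ()
  ... | no x≢i with rdf x (trans (sym ([]≔-minimal g 2F x≢i)) hx)
  ...   | y , xy , gy = y , xy , still-2
    where
    still-2 : (g [ i ]≔ 2F) y ≡ 2F
    still-2 with y ≟ i
    ... | yes refl = []≔-updates g i 2F
    ... | no y≢i  = trans ([]≔-minimal g 2F y≢i) gy

  IsRDF-update : ∀ {g i} c →
    (∀ x → x ≢ i → g x ≡ 0F → ∃[ y ] (y ≢ i × T (adj G x y) × g y ≡ 2F)) →
    (c ≡ 0F → ∃[ y ] (T (adj G i y) × g y ≡ 2F)) →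
    IsRDF G (g [ i ]≔ c)
  IsRDF-update {g} {i} c others at-i x hx with x ≟ i
  ... | yes refl with at-i (trans (sym ([]≔-updates g i c)) hx)
  ...   | y , iy , gy = y , iy , trans ([]≔-minimal g c (adj⇒≢ iy ∘ sym)) gy
  IsRDF-update {g} {i} c others at-i x hx | no x≢i
    with others x x≢i (trans (sym ([]≔-minimal g c x≢i)) hx)
  ... | y , y≢i , xy , gy = y , xy , trans ([]≔-minimal g c y≢i) gy

  IsRDF-lower : ∀ {g i y} → IsRDF G g → g i ≢ 2F → T (adj G i y) → g y ≡ 2F →
    IsRDF G (g [ i ]≔ 0F)
  IsRDF-lower {g} {i} {y} rdf gi≢2 iy gy = IsRDF-update 0F avoid-i (λ _ → y , iy , gy)
    where
    avoid-i : ∀ x → x ≢ i → g x ≡ 0F → ∃[ z ] (z ≢ i × T (adj G x z) × g z ≡ 2F)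
    avoid-i x _ gx with rdf x gx
    ... | z , xz , gz = z , (λ { refl → gi≢2 gz }) , xz , gz

  IsRDF-clear : ∀ {h w} (p : Fin n → Bool) → IsRDF G h → h w ≡ 2F →
    (∀ x → T (p x) → T (adj G w x) × h x ≡ 1F) → IsRDF G (clear p h)
  IsRDF-clear {h} {w} p rdf hw spokes x hx with p x in px
  ... | true  = w , adj-sym (proj₁ (spokes x (subst T (sym px) _))) , clear-keeps-2 p (λ y → proj₂ ∘ spokes y) hw
  ... | false with rdf x hx
  ...   | y , xy , hy = y , xy , clear-keeps-2 p (λ y → proj₂ ∘ spokes y) hy

-- From 2-rainbow to Roman domination

==L⇒≡ : ∀ {l m} → T (l ==L m) → l ≡ m
==L⇒≡ {∅}    {∅}    _ = refl
==L⇒≡ {one}  {one}  _ = refl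
==L⇒≡ {two}  {two}  _ = refl
==L⇒≡ {both} {both} _ = refl

≡⇒==L : ∀ {l m} → l ≡ m → T (l ==L m)
≡⇒==L {∅}    refl = _
≡⇒==L {one}  refl = _
≡⇒==L {two}  refl = _
≡⇒==L {both} refl = _

swap : Label → Label
swap one = two
swap two = one
swap l   = l

opposite : ∀ {F} → Single F → Single (swap F)
opposite s1 = s2
opposite s2 = s1

has : ∀ {F} → Single F → Label → Bool
has s1 = has1
has s2 = has2

has⇒≡ : ∀ {F} (s : Single F) {l} → T (has s l) → l ≢ both → l ≡ F
has⇒≡ s1 {one}  _ _ = refl
has⇒≡ s2 {two}  _ _ = refl
has⇒≡ s1 {both} _ l≢both = contradiction refl l≢both
has⇒≡ s2 {both} _ l≢both = contradiction refl l≢both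

-- The Roman function behind the classical bound γ_R ≤ 3/2 γ_r2.
romanize : ∀ {F} → Single F → Label → Fin 3
romanize _  ∅    = 0F
romanize _  both = 2F
romanize s1 one  = 2F
romanize s1 two  = 1F
romanize s2 one  = 1F
romanize s2 two  = 2F

romanize-∅ : ∀ {F} (s : Single F) {l} → romanize s l ≡ 0F → l ≡ ∅
romanize-∅ s  {∅} _ = refl
romanize-∅ s1 {one} ()
romanize-∅ s1 {two} ()
romanize-∅ s2 {one} ()
romanize-∅ s2 {two} ()

romanize-has : ∀ {F} (s : Single F) {l} → T (has s l) → romanize s l ≡ 2F
romanize-has s1 {one}  _ = refl
romanize-has s1 {both} _ = refl
romanize-has s2 {two}  _ = refl
romanize-has s2 {both} _ = refl

romanize-self : ∀ {F} (s : Single F) → romanize s F ≡ 2F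
romanize-self s1 = refl
romanize-self s2 = refl

romanize-swap : ∀ {F} (s : Single F) → romanize s (swap F) ≡ 1F
romanize-swap s1 = refl
romanize-swap s2 = refl

romanize-opposite : ∀ {F} (s : Single F) → romanize (opposite s) F ≡ 1F
romanize-opposite s1 = refl
romanize-opposite s2 = refl

romanize-size : ∀ {F} (s : Single F) l → toℕ (romanize s l) ≡ size l + 𝟙 (l ==L F)
romanize-size s1 ∅    = refl
romanize-size s1 one  = refl
romanize-size s1 two  = refl
romanize-size s1 both = refl
romanize-size s2 ∅    = refl
romanize-size s2 one  = refl
romanize-size s2 two  = refl
romanize-size s2 both = refl

size-by-colour : ∀ l → size l ≡ (𝟙 (l ==L one) + 𝟙 (l ==L two)) + (𝟙 (l ==L both) + 𝟙 (l ==L both))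
size-by-colour ∅    = refl
size-by-colour one  = refl
size-by-colour two  = refl
size-by-colour both = refl

module _ {n} (G : Graph n) (f : Fin n → Label) (rainbow : Is2RDF G f) where

  rainbow-neighbour : ∀ {F} (s : Single F) u → f u ≡ ∅ → ∃[ v ] (T (adj G u v) × T (has s (f v)))
  rainbow-neighbour s1 u fu = proj₁ (rainbow u fu)
  rainbow-neighbour s2 u fu = proj₂ (rainbow u fu)

  romanize-IsRDF : ∀ {F} (s : Single F) → IsRDF G (romanize s ∘ f)
  romanize-IsRDF s u gu with rainbow-neighbour s u (romanize-∅ s gu)
  ... | v , uv , hv = v , uv , romanize-has s hv

module _ {n} (f : Fin n → Label) where

  weightR-romanize : ∀ {F} (s : Single F) → weightR (romanize s ∘ f) ≡ weightR2 f + nF f F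
  weightR-romanize {F} s = begin
    weightR (romanize s ∘ f)                                   ≡⟨ total-cong (romanize-size s ∘ f) ⟩
    total (λ x → size (f x) + 𝟙 (f x ==L F))                  ≡⟨ total-+ (size ∘ f) (λ x → 𝟙 (f x ==L F)) ⟩
    weightR2 f + total (λ x → 𝟙 (f x ==L F))                  ≡⟨ cong (weightR2 f +_) (count≡total (λ x → f x ==L F)) ⟨
    weightR2 f + nF f F                                        ∎
    where open ≡-Reasoning

  weightR2-by-colour : weightR2 f ≡ (nF f one + nF f two) + (nF f both + nF f both)
  weightR2-by-colour = begin
    total (size ∘ f)                          ≡⟨ total-cong (size-by-colour ∘ f) ⟩
    total (λ x → (I one x + I two x) + (I both x + I both x))
                                              ≡⟨ total-+ (λ x → I one x + I two x) (λ x → I both x + I both x) ⟩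
    total (λ x → I one x + I two x) + total (λ x → I both x + I both x)
                                              ≡⟨ cong₂ _+_ (total-+ (I one) (I two)) (total-+ (I both) (I both)) ⟩
    (total (I one) + total (I two)) + (total (I both) + total (I both))
                                              ≡⟨ cong₂ _+_ (cong₂ _+_ (n≡ one) (n≡ two)) (cong₂ _+_ (n≡ both) (n≡ both)) ⟨
    (nF f one + nF f two) + (nF f both + nF f both) ∎
    where
    open ≡-Reasoning
    I : Label → Fin n → ℕ
    I F x = 𝟙 (f x ==L F)
    n≡ : ∀ F → nF f F ≡ total (I F)
    n≡ F = count≡total (λ x → f x ==L F)

-- Consequences of tightness

¬T-not-∨ : ∀ {a b} → ¬ T (not a ∨ b) → T a × ¬ T b
¬T-not-∨ {true}  ¬t = _ , ¬t
¬T-not-∨ {false} ¬t = contradiction _ ¬t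

≢-by : ∀ {A B : Set} (h : A → B) {x y a b} → h x ≡ a → h y ≡ b → a ≢ b → x ≢ y
≢-by h hx hy a≢b refl = a≢b (trans (sym hx) hy)

module Extremal {n} (G : Graph n) (f : Fin n → Label) (rainbow : Is2RDF G f) (γR : ℕ)
  (minimal : ∀ g → IsRDF G g → γR ≤ weightR g)
  (tight : ∀ {F} (s : Single F) → weightR (romanize s ∘ f) ≡ γR)
  (no-both : ∀ x → f x ≢ both) where

  lighter-absurd : ∀ {F} (s : Single F) {h} → IsRDF G h → weightR h < weightR (romanize s ∘ f) → ⊥
  lighter-absurd s {h} rdf h< = <-irrefl refl (<-≤-trans h< (subst (_≤ weightR h) (sym (tight s)) (minimal h rdf)))

  coloured-neighbour : ∀ {F} (s : Single F) u → f u ≡ ∅ → ∃[ v ] (T (adj G u v) × f v ≡ F)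
  coloured-neighbour s u fu with rainbow-neighbour G f rainbow s u fu
  ... | v , uv , hv = v , uv , has⇒≡ s hv (no-both v)

  no-edge-between-colours : ∀ u v → f u ≡ one → f v ≡ two → T (adj G u v) → ⊥
  no-edge-between-colours u v fu fv uv = lighter-absurd s1 {g [ v ]≔ 0F}
    (IsRDF-lower G {g} {v} (romanize-IsRDF G f rainbow s1) gv≢2 (adj-sym G uv) (cong (romanize s1) fu))
    (≤-reflexive (sym (weightR-lower g v 0F 1 (cong toℕ gv≡1))))
    where
    g : Fin n → Fin 3
    g = romanize s1 ∘ f
    gv≡1 : g v ≡ 1F
    gv≡1 = cong (romanize s1) fv
    gv≢2 : g v ≢ 2F
    gv≢2 gv≡2 = contradiction (trans (sym gv≡1) gv≡2) λ ()

  coloured-degree-bound : ∀ {F} (s : Single F) w → degIn G f F w + toℕ (romanize (opposite s) (f w)) ≤ 2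
  coloured-degree-bound {F} s w = ≮⇒≥ λ 2<d+gw → lighter-absurd (opposite s) {h}
    (IsRDF-clear G p (IsRDF-raise G w (romanize-IsRDF G f rainbow (opposite s))) ([]≔-updates g w 2F) spokes)
    (lighter 2<d+gw)
    where
    p : Fin n → Bool
    p v = adj G w v ∧ (f v ==L F)
    g g↑ h : Fin n → Fin 3
    g = romanize (opposite s) ∘ f
    g↑ = g [ w ]≔ 2F
    h = clear p g↑
    d : ℕ
    d = degIn G f F w
    spokes : ∀ x → T (p x) → T (adj G w x) × g↑ x ≡ 1F
    spokes x px with Equivalence.to T-∧ px
    ... | wx , fx = wx , trans ([]≔-minimal g 2F (adj⇒≢ G wx ∘ sym))
                          (trans (cong (romanize (opposite s)) (==L⇒≡ fx)) (romanize-opposite s))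
    lighter : 2 < d + toℕ (g w) → weightR h < weightR g
    lighter 2<d+gw = +-cancelʳ-< 2 (weightR h) (weightR g) (begin-strict
      weightR h + 2                  <⟨ +-monoʳ-< (weightR h) 2<d+gw ⟩
      weightR h + (d + toℕ (g w))    ≡⟨ +-assoc (weightR h) d (toℕ (g w)) ⟨
      weightR h + d + toℕ (g w)      ≡⟨ cong (_+ toℕ (g w)) (+-comm (weightR h) d) ⟩
      d + weightR h + toℕ (g w)      ≡⟨ cong (_+ toℕ (g w)) (weightR-clear p g↑ (λ x → proj₂ ∘ spokes x)) ⟨
      weightR g↑ + toℕ (g w)         ≡⟨ weightR-update g w 2F ⟨
      weightR g + 2                  ∎)
      where open ≤-Reasoning

  degIn-within-class≤1 : ∀ {F} (s : Single F) u → f u ≡ F → degIn G f F u ≤ 1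
  degIn-within-class≤1 {F} s u fu = +-cancelʳ-≤ 1 (degIn G f F u) 1
    (subst (λ c → degIn G f F u + toℕ c ≤ 2) (trans (cong (romanize (opposite s)) fu) (romanize-opposite s))
      (coloured-degree-bound s u))

  degIn-of-uncoloured : ∀ {F} (s : Single F) u → f u ≡ ∅ → 1 ≤ degIn G f F u × degIn G f F u ≤ 2
  degIn-of-uncoloured {F} s u fu = positive (coloured-neighbour s u fu) ,
    subst (_≤ 2) (+-identityʳ (degIn G f F u))
      (subst (λ c → degIn G f F u + toℕ c ≤ 2) (cong (romanize (opposite s)) fu) (coloured-degree-bound s u))
    where
    positive : ∃[ v ] (T (adj G u v) × f v ≡ F) → 1 ≤ degIn G f F u
    positive (v , uv , fv) = count≥1 (λ x → adj G u x ∧ (f x ==L F)) (Equivalence.from T-∧ (uv , ≡⇒==L fv))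

  module Private {F} (s : Single F) (u : Fin n) (fu : f u ≡ F) where

    isPrivate : Fin n → Bool
    isPrivate v = (f v ==L ∅) ∧ privateNbr G f F u v

    private-neighbour : ∀ {v} → T (isPrivate v) → f v ≡ ∅ × T (adj G v u)
    private-neighbour {v} private-v with Equivalence.to (T-∧ {f v ==L ∅}) private-v
    ... | v∅ , rest = ==L⇒≡ v∅ , proj₁ (Equivalence.to (T-∧ {adj G v u})
                                          (proj₁ (Equivalence.to (T-∧ {adj G v u ∧ (f u ==L F)}) rest)))

    second-neighbour : ∀ x → f x ≡ ∅ → T (adj G x u) → ¬ T (isPrivate x) →
      ∃[ w ] (w ≢ u × T (adj G x w) × f w ≡ F)
    second-neighbour x fx xu ¬private
      with satisfied (¬All⇒Any¬ (T? ∘ solo) (allFin n) (not-all ∘ all⁻ solo))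
      where
      solo : Fin n → Bool
      solo w = not (adj G x w ∧ (f w ==L F)) ∨ ⌊ w ≟ u ⌋
      not-all : ¬ T (all solo (allFin n))
      not-all t = ¬private (Equivalence.from T-∧ (≡⇒==L fx ,
                    Equivalence.from T-∧ (Equivalence.from T-∧ (xu , ≡⇒==L fu) , t)))
    ... | w , ¬solo with ¬T-not-∨ ¬solo
    ...   | xw∧fw , ¬w≡u with Equivalence.to T-∧ xw∧fw
    ...     | xw , fw = w , ¬w≡u ∘ fromWitness , xw , ==L⇒≡ fw

    other-coloured-neighbour : ∀ x → f x ≡ ∅ → ¬ T (isPrivate x) →
      ∃[ y ] (y ≢ u × T (adj G x y) × f y ≡ F)
    other-coloured-neighbour x fx ¬private with coloured-neighbour s x fx
    ... | y , xy , fy with y ≟ u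
    ...   | no y≢u   = y , y≢u , xy , fy
    ...   | yes refl = second-neighbour x fx xy ¬private

    g : Fin n → Fin 3
    g = romanize s ∘ f

    g≡2 : ∀ {y} → f y ≡ F → g y ≡ 2F
    g≡2 fy = trans (cong (romanize s) fy) (romanize-self s)

    no-private-absurd : (∀ x → ¬ T (isPrivate x)) → ⊥
    no-private-absurd none = lighter-absurd s {g [ u ]≔ 1F} (IsRDF-update G {g} {u} 1F avoid-u λ ())
      (≤-reflexive (sym (weightR-lower g u 1F 1 (cong toℕ (g≡2 fu)))))
      where
      avoid-u : ∀ x → x ≢ u → g x ≡ 0F → ∃[ y ] (y ≢ u × T (adj G x y) × g y ≡ 2F)
      avoid-u x _ gx with other-coloured-neighbour x (romanize-∅ s gx) (none x)
      ... | y , y≢u , xy , fy = y , y≢u , xy , g≡2 fy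

    module UniquePrivate (p : Fin n) (private-p : T (isPrivate p))
                         (unique : ∀ x → T (isPrivate x) → x ≡ p) where

      fp : f p ≡ ∅
      fp = proj₁ (private-neighbour private-p)

      pu : T (adj G p u)
      pu = proj₂ (private-neighbour private-p)

      q : Fin n
      q = proj₁ (coloured-neighbour (opposite s) p fp)

      pq : T (adj G p q)
      pq = proj₁ (proj₂ (coloured-neighbour (opposite s) p fp))

      gp : g p ≡ 0F
      gp = cong (romanize s) fp

      gq : g q ≡ 1F
      gq = trans (cong (romanize s) (proj₂ (proj₂ (coloured-neighbour (opposite s) p fp)))) (romanize-swap s)

      q≢p : q ≢ p
      q≢p = ≢-by g gq gp λ ()

      p≢u : p ≢ u
      p≢u = ≢-by g gp (g≡2 fu) λ ()

      -- p takes over the domination duties of u and q.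
      g₁ g₂ g₃ : Fin n → Fin 3
      g₁ = g [ p ]≔ 2F
      g₂ = g₁ [ q ]≔ 0F
      g₃ = g₂ [ u ]≔ 0F

      g₁q : g₁ q ≡ 1F
      g₁q = trans ([]≔-minimal g 2F q≢p) gq

      g₂p : g₂ p ≡ 2F
      g₂p = trans ([]≔-minimal g₁ 0F (q≢p ∘ sym)) ([]≔-updates g p 2F)

      g₂-keeps : ∀ {y} → y ≢ p → y ≢ q → g₂ y ≡ g y
      g₂-keeps y≢p y≢q = trans ([]≔-minimal g₁ 0F y≢q) ([]≔-minimal g 2F y≢p)

      g₂-avoids-u : ∀ x → x ≢ u → g₂ x ≡ 0F → ∃[ y ] (y ≢ u × T (adj G x y) × g₂ y ≡ 2F)
      g₂-avoids-u x x≢u g₂x with x ≟ q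
      ... | yes refl = p , p≢u , adj-sym G pq , g₂p
      ... | no x≢q with x ≟ p
      ...   | yes refl = contradiction (trans (sym g₂p) g₂x) λ ()
      ...   | no x≢p with other-coloured-neighbour x (romanize-∅ s (trans (sym (g₂-keeps x≢p x≢q)) g₂x))
                          (λ private-x → x≢p (unique x private-x))
      ...     | y , y≢u , xy , fy = y , y≢u , xy ,
                  trans (g₂-keeps (≢-by g (g≡2 fy) gp λ ()) (≢-by g (g≡2 fy) gq λ ())) (g≡2 fy)

      g₃-IsRDF : IsRDF G g₃
      g₃-IsRDF = IsRDF-update G {g₂} {u} 0F g₂-avoids-u λ _ → p , adj-sym G pu , g₂p

      weightR-g₃ : weightR g ≡ suc (weightR g₃)
      weightR-g₃ = +-cancelˡ-≡ 2 _ _ (begin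
        2 + weightR g       ≡⟨ weightR-raise g p 2F 2 (cong (λ c → 2 + toℕ c) (sym gp)) ⟨
        weightR g₁          ≡⟨ weightR-lower g₁ q 0F 1 (cong toℕ g₁q) ⟩
        1 + weightR g₂      ≡⟨ cong suc (weightR-lower g₂ u 0F 2 (cong toℕ g₂u)) ⟩
        3 + weightR g₃      ∎)
        where
        open ≡-Reasoning
        g₂u : g₂ u ≡ 2F
        g₂u = trans (g₂-keeps (p≢u ∘ sym) (≢-by g (g≡2 fu) gq λ ())) (g≡2 fu)

    privCount≥2 : 2 ≤ privCount G f F u
    privCount≥2 = ≮⇒≥ λ count<2 →
      [ no-private-absurd , unique-private-absurd ] (count≤1 isPrivate (≤-pred count<2))
      where
      unique-private-absurd : ∃[ p ] (T (isPrivate p) × ∀ x → T (isPrivate x) → x ≡ p) → ⊥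
      unique-private-absurd (p , private-p , unique) =
        lighter-absurd s g₃-IsRDF (≤-reflexive (sym weightR-g₃))
        where open UniquePrivate p private-p unique

-- 3W = 2γ ≤ 2W + 2x gives W ≤ 2x for x = a, b; with W = a + b + 2c this forces c = 0 and a = b.
balance : ∀ {γ W a b c} → 2 * γ ≡ 3 * W → γ ≤ W + a → γ ≤ W + b → W ≡ (a + b) + (c + c) →
  a ≡ b × c ≡ 0 × W + a ≡ γ
balance {γ} {W} {a} {b} {c} 2γ≡3W γ≤W+a γ≤W+b W≡ = a≡b , c≡0 , W+a≡γ
  where
  at-most-double : ∀ x → γ ≤ W + x → W ≤ x + x
  at-most-double x γ≤W+x = +-cancelˡ-≤ (W + W) W (x + x) (begin
    W + W + W           ≡⟨ triple W ⟩
    3 * W               ≡⟨ 2γ≡3W ⟨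
    2 * γ               ≤⟨ *-monoʳ-≤ 2 γ≤W+x ⟩
    2 * (W + x)         ≡⟨ double-sum W x ⟩
    W + W + (x + x)     ∎)
    where
    open ≤-Reasoning
    triple : ∀ w → w + w + w ≡ 3 * w
    triple = solve-∀
    double-sum : ∀ w x → 2 * (w + x) ≡ w + w + (x + x)
    double-sum = solve-∀
  excess : ∀ x y → γ ≤ W + x → W ≡ x + (y + (c + c)) → y + (c + c) ≤ x
  excess x y γ≤W+x W≡x+y+2c = +-cancelˡ-≤ x (y + (c + c)) x
    (subst (_≤ x + x) W≡x+y+2c (at-most-double x γ≤W+x))
  b+2c≤a : b + (c + c) ≤ a
  b+2c≤a = excess a b γ≤W+a (trans W≡ (+-assoc a b (c + c)))
  a+2c≤b : a + (c + c) ≤ b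
  a+2c≤b = excess b a γ≤W+b (trans W≡ (trans (cong (_+ (c + c)) (+-comm a b)) (+-assoc b a (c + c))))
  a+2c≤a : a + (c + c) ≤ a + 0
  a+2c≤a = begin
    a + (c + c)   ≤⟨ a+2c≤b ⟩
    b             ≤⟨ m≤m+n b (c + c) ⟩
    b + (c + c)   ≤⟨ b+2c≤a ⟩
    a             ≡⟨ +-identityʳ a ⟨
    a + 0         ∎
    where open ≤-Reasoning
  c≡0 : c ≡ 0
  c≡0 = m+n≡0⇒m≡0 c (n≤0⇒n≡0 (+-cancelˡ-≤ a (c + c) 0 a+2c≤a))
  a≡b : a ≡ b
  a≡b = ≤-antisym (≤-trans (m≤m+n a (c + c)) a+2c≤b) (≤-trans (m≤m+n b (c + c)) b+2c≤a)
  W≡2a : W ≡ a + a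
  W≡2a = trans W≡ (trans (cong₂ (λ y z → (a + y) + (z + z)) (sym a≡b) c≡0) (+-identityʳ (a + a)))
  W+a≡γ : W + a ≡ γ
  W+a≡γ = *-cancelˡ-≡ (W + a) γ 2 (begin
    2 * (W + a)         ≡⟨ cong (λ w → 2 * (w + a)) W≡2a ⟩
    2 * (a + a + a)     ≡⟨ regroup a ⟩
    3 * (a + a)         ≡⟨ cong (3 *_) W≡2a ⟨
    3 * W               ≡⟨ 2γ≡3W ⟨
    2 * γ               ∎)
    where
    open ≡-Reasoning
    regroup : ∀ a → 2 * (a + a + a) ≡ 3 * (a + a)
    regroup = solve-∀

theorem6 : ∀ {n} (G : Graph n) (γR γr2 : ℕ) → IsGammaR G γR → IsGammaR2 G γr2 →
    2 * γR ≡ 3 * γr2 →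
    ∀ (f : Fin n → Label) → Is2RDF G f → weightR2 f ≡ γr2 →
    (nF f one ≡ nF f two × nF f both ≡ 0) ×
    (∀ u v → f u ≡ one → f v ≡ two → T (adj G u v) → ⊥) ×
    (∀ {F} → Single F → ∀ u → f u ≡ F → degIn G f F u ≤ 1) ×
    (∀ {F} → Single F → ∀ u → f u ≡ ∅ → 1 ≤ degIn G f F u × degIn G f F u ≤ 2) ×
    (∀ {F} → Single F → ∀ u → f u ≡ F → 2 ≤ privCount G f F u)
theorem6 G γR _ (_ , minimal) _ 2γR≡3W f rainbow refl =
  (n₁≡n₂ , n₁₂≡0) , no-edge-between-colours , degIn-within-class≤1 , degIn-of-uncoloured ,
  Private.privCount≥2
  where
  romanize-bound : ∀ {F} (s : Single F) → γR ≤ weightR2 f + nF f F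
  romanize-bound s = subst (γR ≤_) (weightR-romanize f s) (minimal _ (romanize-IsRDF G f rainbow s))
  balanced : nF f one ≡ nF f two × nF f both ≡ 0 × weightR2 f + nF f one ≡ γR
  balanced = balance 2γR≡3W (romanize-bound s1) (romanize-bound s2) (weightR2-by-colour f)
  n₁≡n₂ : nF f one ≡ nF f two
  n₁≡n₂ = proj₁ balanced
  n₁₂≡0 : nF f both ≡ 0
  n₁₂≡0 = proj₁ (proj₂ balanced)
  tight : ∀ {F} (s : Single F) → weightR (romanize s ∘ f) ≡ γR
  tight s1 = trans (weightR-romanize f s1) (proj₂ (proj₂ balanced))
  tight s2 = trans (weightR-romanize f s2) (trans (cong (weightR2 f +_) (sym n₁≡n₂)) (proj₂ (proj₂ balanced)))
  no-both : ∀ x → f x ≢ both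
  no-both x fx = contradiction (subst (1 ≤_) n₁₂≡0 (count≥1 (λ v → f v ==L both) (≡⇒==L fx))) λ ()
  open Extremal G f rainbow γR minimal tight no-both
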